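{- Let $K=\mathbb{Q}(\sqrt{D})$ where $D\in\mathbb{Z}_{\ge2}$ is squarefree. Then: - $p_K(3)=3$ for $D\in\{2,3\}$ and for $D>5$; - $p_K(4)=5$ for $D>5$; - $p_K(5)=7$ for $D\equiv2,3\pmod4$ with $D>4$, and for $D\equiv1\pmod4$ with $D>25$; - $p_K(6)=11$ for $D\equiv2,3\pmod4$ with $D>9$, and for $D\equiv1\pmod4$ with $D>25$.
   Context: $\mathcal{O}_K$ is the ring of integers of $K$ and $\mathcal{O}_K^+$ is the set of totally positive elements of $\mathcal{O}_K$ (elements $\gamma$ with $\gamma>0$ and $\gamma'>0$, where $'$ denotes Galois conjugation). A partition of $\alpha\in\mathcal{O}_K^+$ is an expression $\alpha=\alpha_1+\dots+\alpha_k$ with $k\ge1$ and all $\alpha_i\in\mathcal{O}_K^+$, the order of the summands being irrelevant; $p_K(\alpha)$ is the number of partitions of $\alpha$. -}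

module Defs where

open import Data.Nat as ℕ using (ℕ; _%_)
open import Data.Nat.Divisibility as ℕD using ()
open import Data.Integer as ℤ using (ℤ; +_; _+_; _*_; _-_; _<_)
open import Data.Integer.Divisibility using (_∣_)
open import Data.Product using (Σ; ∃; _×_; _,_)
open import Data.List using (List; []; _∷_; length; foldr)
open import Data.List.Relation.Unary.All using (All)
open import Data.List.Relation.Binary.Permutation.Propositional using (_↭_)
open import Data.Fin using (Fin)
open import Relation.Binary.PropositionalEquality using (_≡_)
open import Relation.Nullary using (¬_)

SquareFree : ℕ → Set
SquareFree D = ∀ (k : ℕ) → (k ℕ.* k) ℕD.∣ D → k ≡ 1

-- An element of K = ℚ(√D) of the form (a + b√D)/2, encoded by the pair (a , b).
-- This encoding is injective (√D irrational for squarefree D ≥ 2).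
Elem : Set
Elem = ℤ × ℤ

-- (a + b√D)/2 lies in 𝒪_K:
--   D ≡ 1 (mod 4): 𝒪_K = ℤ[(1+√D)/2] = {(a+b√D)/2 : a ≡ b (mod 2)}
--   D ≡ 2,3 (mod 4): 𝒪_K = ℤ[√D]     = {(a+b√D)/2 : a, b even}
InOK : ℕ → Elem → Set
InOK D (a , b) = ((+ 2) ∣ (a - b)) × (¬ (D % 4 ≡ 1) → ((+ 2) ∣ a) × ((+ 2) ∣ b))

-- (a + b√D)/2 is totally positive: (a+b√D)/2 > 0 and (a-b√D)/2 > 0,
-- i.e. a > |b|√D, i.e. a > 0 and D b² < a².
TotPos : ℕ → Elem → Set
TotPos D (a , b) = (+ 0 < a) × (b * b * + D < a * a)

InOKPlus : ℕ → Elem → Set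
InOKPlus D x = InOK D x × TotPos D x

addE : Elem → Elem → Elem
addE (a , b) (c , d) = (a + c , b + d)

sumE : List Elem → Elem
sumE = foldr addE (+ 0 , + 0)

IsPartition : ℕ → Elem → List Elem → Set
IsPartition D α L = (0 ℕ.< length L) × All (InOKPlus D) L × (sumE L ≡ α)

-- p_K(α) = n: partitions (lists up to reordering, i.e. up to permutation ↭)
-- fall into exactly n classes: n pairwise non-equivalent partitions such that
-- every partition is a reordering of one of them.
PartitionCount : ℕ → Elem → ℕ → Set
PartitionCount D α n =
  Σ (Fin n → List Elem) λ ps →
    (∀ i → IsPartition D α (ps i)) ×
    (∀ i j → ps i ↭ ps j → i ≡ j) ×
    (∀ L → IsPartition D α L → ∃ λ i → L ↭ ps i)

natE : ℕ → Elem
natE m = (+ (2 ℕ.* m) , + 0)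

{-# OPTIONS --safe #-}
module Submission where

-- Write elements of 𝒪_K as (a + b√D)/2. Suppose every totally positive integer with b ≠ 0 has
-- trace a > n. A partition of n has total trace 2n and total b = 0, so it has no irrational
-- summand: a single one would leave the b-sum nonzero, two would already have trace > 2n. Hence
-- p_K(n) is the number p(n) of partitions of n in ℕ, i.e. of distinct sorted compositions of n,
-- and p(3), …, p(6) = 3, 5, 7, 11 by evaluation. Total positivity forces |b| < a, so the
-- trace bound is a finite search, done once for a single D₀ ≤ D in the residue class of D
-- mod 4; raising D inside a class only removes pairs (a , b) from 𝒪_K^+.

open import Defs
open import Data.Nat using (ℕ; _≤_; _<_; _%_)
open import Data.Product using (_×_)
open import Data.Sum using (_⊎_)
open import Relation.Binary.PropositionalEquality using (_≡_)

open import Data.Nat.Base using (zero; suc; _+_; _*_; _/_; z≤n; s≤s; NonZero; ≢-nonZero⁻¹)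
import Data.Nat.Properties as ℕ
open import Data.Nat.Divisibility using (divides; _∣?_)
open import Data.Nat.DivMod using (m*n/n≡m)
open import Data.Nat.ListAction using (sum)
open import Data.Nat.ListAction.Properties using (sum-↭)
open import Data.Integer.Base as ℤ using (ℤ; +_; -[1+_]; ∣_∣; +<+; +≤+)
import Data.Integer.Properties as ℤₚ
open import Data.Product using (∃; _,_; proj₁; proj₂)
open import Data.Sum using (inj₁; inj₂)
open import Data.Empty using (⊥-elim)
open import Data.Fin.Base using (Fin; zero; suc)
open import Data.List.Base using (List; []; _∷_; [_]; _++_; map; length; lookup; deduplicate)
import Data.List.Properties as List
open import Data.List.Relation.Unary.All as All using (All; []; _∷_)
import Data.List.Relation.Unary.All.Properties as All
open import Data.List.Relation.Unary.AllPairs using (_∷_)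
open import Data.List.Relation.Unary.Any as Any using (here)
open import Data.List.Relation.Unary.Any.Properties using (lookup-index)
open import Data.List.Relation.Unary.Unique.Propositional using (Unique)
open import Data.List.Relation.Unary.Unique.DecPropositional.Properties (List.≡-dec ℕ._≟_)
  using (deduplicate-!)
open import Data.List.Relation.Unary.Sorted.TotalOrder ℕ.≤-totalOrder using (Sorted)
open import Data.List.Relation.Unary.Sorted.TotalOrder.Properties using (↗↭↗⇒≋)
open import Data.List.Membership.Propositional using (_∈_)
open import Data.List.Membership.Propositional.Properties
  using (∈-map⁺; ∈-map⁻; ∈-++⁺ˡ; ∈-++⁺ʳ; ∈-deduplicate⁺; ∈-deduplicate⁻; ∈-lookup)
open import Data.List.Relation.Binary.Permutation.Propositional using (_↭_; ↭-sym; ↭⇒↭ₛ)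
import Data.List.Relation.Binary.Permutation.Propositional.Properties as Perm
open import Data.List.Relation.Binary.Pointwise using (Pointwise-≡⇒≡)
open import Data.List.Sort.InsertionSort ℕ.≤-decTotalOrder using (sort)
open import Data.List.Sort.InsertionSort.Properties ℕ.≤-decTotalOrder using (sort-↭; sort-↗)
open import Function.Base using (_∘_; const)
open import Relation.Binary.PropositionalEquality using (refl; sym; trans; cong; subst; subst₂; _≢_)
open import Relation.Nullary using (¬_; Dec; yes; no; ¬?; contradiction; contraposition)
open import Relation.Nullary.Decidable using (True; toWitness; _×-dec_; _→-dec_)

private
  variable
    A T n D D₀ : ℕ
    b : ℤ
    x : Elem
    xs ys ks : List ℕ

↭-map⁻ : ∀ {X Y : Set} {f : X → Y} {xs ys : List X} (g : Y → X) → (∀ x → g (f x) ≡ x) →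
         map f xs ↭ map f ys → xs ↭ ys
↭-map⁻ {f = f} {xs} {ys} g g∘f≗id p = subst₂ _↭_ (retract xs) (retract ys) (Perm.map⁺ g p)
  where
  retract : ∀ zs → map g (map f zs) ≡ zs
  retract zs = trans (sym (List.map-∘ zs)) (trans (List.map-cong g∘f≗id zs) (List.map-id zs))

↗↭↗⇒≡ : Sorted xs → Sorted ys → xs ↭ ys → xs ≡ ys
↗↭↗⇒≡ xs↗ ys↗ xs↭ys = Pointwise-≡⇒≡ (↗↭↗⇒≋ ℕ.≤-totalOrder xs↗ ys↗ (↭⇒↭ₛ xs↭ys))

lookup-injective : ∀ {X : Set} {xs : List X} {i j} → Unique xs → lookup xs i ≡ lookup xs j → i ≡ j
lookup-injective {xs = _ ∷ _} {zero}  {zero}  _          _  = refl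
lookup-injective {xs = _ ∷ _} {zero}  {suc j} (x∉ ∷ _)   eq =
  contradiction eq (All.lookup x∉ (∈-lookup j))
lookup-injective {xs = _ ∷ _} {suc i} {zero}  (x∉ ∷ _)   eq =
  contradiction (sym eq) (All.lookup x∉ (∈-lookup i))
lookup-injective {xs = _ ∷ _} {suc i} {suc j} (_ ∷ uniq) eq = cong suc (lookup-injective uniq eq)

Composition : ℕ → List ℕ → Set
Composition n ks = All (0 <_) ks × sum ks ≡ n

incrementHead : List ℕ → List ℕ
incrementHead []       = []
incrementHead (k ∷ ks) = suc k ∷ ks

compositions : ℕ → List (List ℕ)
compositions 0             = [ [] ]
compositions 1             = [ [ 1 ] ]
compositions (suc (suc n)) =
  map (1 ∷_) (compositions (suc n)) ++ map incrementHead (compositions (suc n))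

suc∷-∈-compositions : ∀ j → All (0 <_) ks → suc j ∷ ks ∈ compositions (suc j + sum ks)
suc∷-∈-compositions zero    []                     = here refl
suc∷-∈-compositions zero    (s≤s {n = k} z≤n ∷ pos) =
  ∈-++⁺ˡ (∈-map⁺ (1 ∷_) (suc∷-∈-compositions k pos))
suc∷-∈-compositions (suc j) pos                    =
  ∈-++⁺ʳ _ (∈-map⁺ incrementHead (suc∷-∈-compositions j pos))

∈-compositions⁺ : Composition n ks → ks ∈ compositions n
∈-compositions⁺ ([]            , refl) = here refl
∈-compositions⁺ (s≤s z≤n ∷ pos , refl) = suc∷-∈-compositions _ pos

1∷-Composition : Composition n ks → Composition (suc n) (1 ∷ ks)
1∷-Composition (pos , Σ≡n) = s≤s z≤n ∷ pos , cong suc Σ≡n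

incrementHead-Composition : Composition (suc n) ks → Composition (suc (suc n)) (incrementHead ks)
incrementHead-Composition (_ ∷ pos , Σ≡n) = s≤s z≤n ∷ pos , cong suc Σ≡n

compositions-sound : ∀ n → All (Composition n) (compositions n)
compositions-sound 0             = ([] , refl) ∷ []
compositions-sound 1             = (s≤s z≤n ∷ [] , refl) ∷ []
compositions-sound (suc (suc n)) =
  All.++⁺ (All.map⁺ (All.map 1∷-Composition (compositions-sound (suc n))))
          (All.map⁺ (All.map incrementHead-Composition (compositions-sound (suc n))))

Composition-resp-↭ : xs ↭ ys → Composition n xs → Composition n ys
Composition-resp-↭ xs↭ys (pos , Σ≡n) =
  Perm.All-resp-↭ xs↭ys pos , trans (sym (sum-↭ xs↭ys)) Σ≡n

partitions : ℕ → List (List ℕ)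
partitions n = deduplicate (List.≡-dec ℕ._≟_) (map sort (compositions n))

∈-partitions⁺ : Composition n ks → sort ks ∈ partitions n
∈-partitions⁺ = ∈-deduplicate⁺ (List.≡-dec ℕ._≟_) ∘ ∈-map⁺ sort ∘ ∈-compositions⁺

∈-partitions⁻ : ks ∈ partitions n → Sorted ks × Composition n ks
∈-partitions⁻ {n = n} ks∈
  with cs , cs∈ , refl ← ∈-map⁻ sort (∈-deduplicate⁻ _ (map sort (compositions n)) ks∈)
  = sort-↗ cs , Composition-resp-↭ (↭-sym (sort-↭ cs)) (All.lookup (compositions-sound n) cs∈)

partitions-unique : ∀ n → Unique (partitions n)
partitions-unique n = deduplicate-! (map sort (compositions n))

sumE-map-natE : ∀ ks → sumE (map natE ks) ≡ natE (sum ks)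
sumE-map-natE []       = refl
sumE-map-natE (k ∷ ks) rewrite sumE-map-natE ks =
  cong (λ m → (+ m , + 0)) (sym (ℕ.*-distribˡ-+ 2 k (sum ks)))

natE-injective : natE A ≡ natE n → A ≡ n
natE-injective {A} {n} eq = ℕ.*-cancelˡ-≡ A n 2 (ℤₚ.+-injective (cong proj₁ eq))

natE∈𝒪⁺ : 0 < n → InOKPlus D (natE n)
natE∈𝒪⁺ {suc m} _ = (2∣2n+0 , const (2∣2n , divides 0 refl)) , +<+ (s≤s z≤n) , +<+ (s≤s z≤n)
  where
  2∣2n = divides (suc m) (ℕ.*-comm 2 (suc m))
  2∣2n+0 = divides (suc m) (trans (ℕ.+-identityʳ _) (ℕ.*-comm 2 (suc m)))

halfTrace : Elem → ℕ
halfTrace (a , _) = ∣ a ∣ / 2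

halfTrace-natE : ∀ m → halfTrace (natE m) ≡ m
halfTrace-natE m = trans (cong (_/ 2) (ℕ.*-comm 2 m)) (m*n/n≡m m 2)

IrrationalTraceBound : ℕ → ℕ → Set
IrrationalTraceBound D T = ∀ {A b} → InOKPlus D (+ A , b) → b ≢ + 0 → T ≤ A

data RationalOrTraceAtLeast (T : ℕ) : Elem → Set where
  rational   : ∀ m → RationalOrTraceAtLeast T (natE (suc m))
  irrational : b ≢ + 0 → T ≤ A → RationalOrTraceAtLeast T (+ A , b)

positiveEven-rational : ∀ q → A ≡ q * 2 → 0 < A → RationalOrTraceAtLeast T (+ A , + 0)
positiveEven-rational         zero    refl ()
positiveEven-rational {T = T} (suc m) refl _  =
  subst (λ a → RationalOrTraceAtLeast T (+ a , + 0)) (ℕ.*-comm 2 (suc m)) (rational m)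

rationalOrTraceAtLeast : IrrationalTraceBound D T → InOKPlus D x → RationalOrTraceAtLeast T x
rationalOrTraceAtLeast {x = _ , b} bound x∈𝒪⁺@((divides q A+0≡q*2 , _) , +<+ 0<A , _)
  with b ℤₚ.≟ + 0
... | no  b≢0  = irrational b≢0 (bound x∈𝒪⁺ b≢0)
... | yes refl = positiveEven-rational q (trans (sym (ℕ.+-identityʳ _)) A+0≡q*2) 0<A

data IrrationalSummands (T : ℕ) : List Elem → Set where
  none : All (0 <_) ks → IrrationalSummands T (map natE ks)
  one  : ∀ {L} → proj₂ (sumE L) ≢ + 0 → + T ℤ.≤ proj₁ (sumE L) → IrrationalSummands T L
  many : ∀ {L} → + (T + T) ℤ.≤ proj₁ (sumE L) → IrrationalSummands T L

irrationalSummands : ∀ {L} → All (RationalOrTraceAtLeast T) L → IrrationalSummands T L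
irrationalSummands [] = none {ks = []} []
irrationalSummands (rational m ∷ rest) with irrationalSummands rest
... | none pos    = none (s≤s z≤n ∷ pos)
... | one b≢0 T≤a = one (b≢0 ∘ trans (sym (ℤₚ.+-identityˡ _))) (ℤₚ.i≤j⇒i≤k+j _ T≤a)
... | many 2T≤a   = many (ℤₚ.i≤j⇒i≤k+j _ 2T≤a)
irrationalSummands {T = T} (irrational {b = b} {A = A} b≢0 T≤A ∷ rest) with irrationalSummands rest
... | none {ks} _ = one b+Σ≢0 T≤A+Σ
  where
  b+Σ≢0 : b ℤ.+ proj₂ (sumE (map natE ks)) ≢ + 0
  b+Σ≢0 rewrite sumE-map-natE ks | ℤₚ.+-identityʳ b = b≢0
  T≤A+Σ : + T ℤ.≤ + A ℤ.+ proj₁ (sumE (map natE ks))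
  T≤A+Σ rewrite sumE-map-natE ks = ℤₚ.≤-trans (+≤+ T≤A) (ℤₚ.i≤i+j (+ A) _)
... | one _ T≤a   = many (ℤₚ.+-mono-≤ (+≤+ T≤A) T≤a)
... | many 2T≤a   = many (ℤₚ.i≤j⇒i≤k+j _ 2T≤a)

2n<2[1+n] : ∀ n → 2 * n < suc n + suc n
2n<2[1+n] n = ℕ.+-mono-< (ℕ.n<1+n n) (ℕ.≤-<-trans (ℕ.≤-reflexive (ℕ.+-identityʳ n)) (ℕ.n<1+n n))

IsPartition⇒Composition : ∀ {L} → IrrationalTraceBound D (suc n) → IsPartition D (natE n) L →
                          ∃ λ ks → Composition n ks × L ≡ map natE ks
IsPartition⇒Composition {n = n} bound (_ , L⊆𝒪⁺ , ΣL≡n)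
  with irrationalSummands (All.map (rationalOrTraceAtLeast bound) L⊆𝒪⁺)
... | none {ks} pos = ks , (pos , natE-injective (trans (sym (sumE-map-natE ks)) ΣL≡n)) , refl
... | one Σb≢0 _    = contradiction (cong proj₂ ΣL≡n) Σb≢0
... | many 2T≤Σa    = contradiction (ℤₚ.drop‿+≤+ (subst (_ ℤ.≤_) (cong proj₁ ΣL≡n) 2T≤Σa))
                                    (ℕ.<⇒≱ (2n<2[1+n] n))

Composition⇒IsPartition : .{{NonZero n}} → Composition n ks → IsPartition D (natE n) (map natE ks)
Composition⇒IsPartition {n} {ks} {D} (pos , Σks≡n) =
  nonempty ks Σks≡n , All.map⁺ (All.map (natE∈𝒪⁺ {D = D}) pos) , ΣE≡n
  where
  nonempty : ∀ ks → sum ks ≡ n → 0 < length (map natE ks)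
  nonempty []      Σ[]≡n = contradiction (sym Σ[]≡n) (≢-nonZero⁻¹ n)
  nonempty (_ ∷ _) _     = s≤s z≤n
  ΣE≡n : sumE (map natE ks) ≡ natE n
  ΣE≡n = trans (sumE-map-natE ks) (cong natE Σks≡n)

partitionCount : .{{NonZero n}} → IrrationalTraceBound D (suc n) →
                 PartitionCount D (natE n) (length (partitions n))
partitionCount {n} {D} bound = ps , isPartition , distinct , complete
  where
  ps : Fin (length (partitions n)) → List Elem
  ps i = map natE (lookup (partitions n) i)

  entry : ∀ i → Sorted (lookup (partitions n) i) × Composition n (lookup (partitions n) i)
  entry i = ∈-partitions⁻ (∈-lookup i)

  isPartition : ∀ i → IsPartition D (natE n) (ps i)
  isPartition i = Composition⇒IsPartition (proj₂ (entry i))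

  distinct : ∀ i j → ps i ↭ ps j → i ≡ j
  distinct i j p = lookup-injective (partitions-unique n)
    (↗↭↗⇒≡ (proj₁ (entry i)) (proj₁ (entry j)) (↭-map⁻ halfTrace halfTrace-natE p))

  complete : ∀ L → IsPartition D (natE n) L → ∃ λ i → L ↭ ps i
  complete _ L-partition
    with ks , ks-composition , refl ← IsPartition⇒Composition bound L-partition =
    Any.index sort-ks∈ ,
    subst (λ qs → map natE ks ↭ map natE qs) (lookup-index sort-ks∈)
          (Perm.map⁺ natE (↭-sym (sort-↭ ks)))
    where sort-ks∈ = ∈-partitions⁺ ks-composition

b*b*D≡∣b∣*∣b∣*D : ∀ b D → b ℤ.* b ℤ.* + D ≡ + (∣ b ∣ * ∣ b ∣ * D)
b*b*D≡∣b∣*∣b∣*D (+ m)    D = trans (cong (ℤ._* + D) (sym (ℤₚ.pos-* m m))) (sym (ℤₚ.pos-* (m * m) D))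
b*b*D≡∣b∣*∣b∣*D -[1+ m ] D = sym (ℤₚ.pos-* (suc m * suc m) D)

TotPos-antitone : D₀ ≤ D → TotPos D x → TotPos D₀ x
TotPos-antitone {D₀} {D} {_ , b} D₀≤D (0<a , bbD<aa) = 0<a , ℤₚ.≤-<-trans bbD₀≤bbD bbD<aa
  where
  bbD₀≤bbD : b ℤ.* b ℤ.* + D₀ ℤ.≤ b ℤ.* b ℤ.* + D
  bbD₀≤bbD = subst₂ ℤ._≤_ (sym (b*b*D≡∣b∣*∣b∣*D b D₀)) (sym (b*b*D≡∣b∣*∣b∣*D b D))
                          (+≤+ (ℕ.*-monoʳ-≤ (∣ b ∣ * ∣ b ∣) D₀≤D))

TotPos⇒∣b∣<A : .{{NonZero D}} → TotPos D (+ A , b) → ∣ b ∣ < A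
TotPos⇒∣b∣<A {D} {A} {b} (_ , bbD<AA) = ℕ.≰⇒> λ A≤∣b∣ →
  ℕ.<⇒≱ bbD<AAₙ (ℕ.≤-trans (ℕ.*-mono-≤ A≤∣b∣ A≤∣b∣) (ℕ.m≤m*n (∣ b ∣ * ∣ b ∣) D))
  where
  bbD<AAₙ : ∣ b ∣ * ∣ b ∣ * D < A * A
  bbD<AAₙ = ℤₚ.drop‿+<+ (subst₂ ℤ._<_ (b*b*D≡∣b∣*∣b∣*D b D) (sym (ℤₚ.pos-* A A)) bbD<AA)

irrationalTraceBound-mono : D₀ ≤ D → (D % 4 ≡ 1 → D₀ % 4 ≡ 1) →
                            IrrationalTraceBound D₀ T → IrrationalTraceBound D T
irrationalTraceBound-mono D₀≤D residue bound {A} {b} ((2∣a-b , even) , totPos) =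
  bound ((2∣a-b , even ∘ contraposition residue) , TotPos-antitone {x = + A , b} D₀≤D totPos)

NoSmallIrrational : ℕ → ℕ → Set
NoSmallIrrational D T =
  ∀ {A} → A < T → ∀ {B} → B < A → ¬ InOKPlus D (+ A , + suc B) × ¬ InOKPlus D (+ A , -[1+ B ])

inOKPlus? : ∀ D x → Dec (InOKPlus D x)
inOKPlus? D (a , b) =
  ((2 ∣? ∣ a ℤ.- b ∣) ×-dec (¬? (D % 4 ℕ.≟ 1) →-dec (2 ∣? ∣ a ∣ ×-dec 2 ∣? ∣ b ∣)))
  ×-dec ((+ 0 ℤₚ.<? a) ×-dec (b ℤ.* b ℤ.* + D ℤₚ.<? a ℤ.* a))

noSmallIrrational? : ∀ D T → Dec (NoSmallIrrational D T)
noSmallIrrational? D = ℕ.allUpTo? λ A → ℕ.allUpTo? (λ B →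
  ¬? (inOKPlus? D (+ A , + suc B)) ×-dec ¬? (inOKPlus? D (+ A , -[1+ B ]))) A

irrationalTraceBound : .{{NonZero D}} → NoSmallIrrational D T → IrrationalTraceBound D T
irrationalTraceBound {D} {T} noSmall {A} {b} x∈𝒪⁺ b≢0 with T ℕ.≤? A
... | yes T≤A = T≤A
... | no  T≰A = contradiction x∈𝒪⁺ (excluded b b≢0 (TotPos⇒∣b∣<A {b = b} (proj₂ x∈𝒪⁺)))
  where
  excluded : ∀ b → b ≢ + 0 → ∣ b ∣ < A → ¬ InOKPlus D (+ A , b)
  excluded (+ zero)  0≢0 _   = contradiction refl 0≢0
  excluded (+ suc B) _   B<A = proj₁ (noSmall (ℕ.≰⇒> T≰A) (ℕ.<⇒≤ B<A))
  excluded -[1+ B ]  _   B<A = proj₂ (noSmall (ℕ.≰⇒> T≰A) (ℕ.<⇒≤ B<A))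

mod4≢1 : D % 4 ≡ 2 ⊎ D % 4 ≡ 3 → D % 4 ≢ 1
mod4≢1 (inj₁ ≡2) ≡1 = contradiction (trans (sym ≡2) ≡1) λ ()
mod4≢1 (inj₂ ≡3) ≡1 = contradiction (trans (sym ≡3) ≡1) λ ()

mod4≡1⇒9≤ : D ≡ 2 ⊎ D ≡ 3 ⊎ 5 < D → D % 4 ≡ 1 → 9 ≤ D
mod4≡1⇒9≤ (inj₁ refl)        ()
mod4≡1⇒9≤ (inj₂ (inj₁ refl)) ()
mod4≡1⇒9≤ (inj₂ (inj₂ 5<D))  ≡1 with k , refl ← ℕ.m≤n⇒∃[o]m+o≡n 5<D = 9≤6+ k ≡1
  where
  9≤6+ : ∀ k → (6 + k) % 4 ≡ 1 → 9 ≤ 6 + k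
  9≤6+ 0 ()
  9≤6+ 1 ()
  9≤6+ 2 ()
  9≤6+ (suc (suc (suc k))) _ = ℕ.m≤m+n 9 k

corollary5p2 : (D : ℕ) → 2 ≤ D → SquareFree D →
    ((D ≡ 2 ⊎ D ≡ 3 ⊎ 5 < D) → PartitionCount D (natE 3) 3)
    × (5 < D → PartitionCount D (natE 4) 5)
    × ((((D % 4 ≡ 2 ⊎ D % 4 ≡ 3) × 4 < D) ⊎ (D % 4 ≡ 1 × 25 < D)) → PartitionCount D (natE 5) 7)
    × ((((D % 4 ≡ 2 ⊎ D % 4 ≡ 3) × 9 < D) ⊎ (D % 4 ≡ 1 × 25 < D)) → PartitionCount D (natE 6) 11)
corollary5p2 D 2≤D _ = p₃ , p₄ , p₅ , p₆
  where
  count : ∀ n D₀ .{{_ : NonZero n}} .{{_ : NonZero D₀}}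
          {noSmall : True (noSmallIrrational? D₀ (suc n))} → D₀ ≤ D → (D % 4 ≡ 1 → D₀ % 4 ≡ 1) →
          PartitionCount D (natE n) (length (partitions n))
  count n D₀ {noSmall = noSmall} D₀≤D residue = partitionCount
    (irrationalTraceBound-mono D₀≤D residue (irrationalTraceBound (toWitness noSmall)))

  p₃ : (D ≡ 2 ⊎ D ≡ 3 ⊎ 5 < D) → PartitionCount D (natE 3) 3
  p₃ h with D % 4 ℕ.≟ 1
  ... | yes ≡1 = count 3 9 (mod4≡1⇒9≤ h ≡1) (const refl)
  ... | no  ≢1 = count 3 2 2≤D (⊥-elim ∘ ≢1)

  p₄ : 5 < D → PartitionCount D (natE 4) 5
  p₄ 5<D with D % 4 ℕ.≟ 1
  ... | yes ≡1 = count 4 9 (mod4≡1⇒9≤ (inj₂ (inj₂ 5<D)) ≡1) (const refl)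
  ... | no  ≢1 = count 4 6 5<D (⊥-elim ∘ ≢1)

  p₅ : (((D % 4 ≡ 2 ⊎ D % 4 ≡ 3) × 4 < D) ⊎ (D % 4 ≡ 1 × 25 < D)) → PartitionCount D (natE 5) 7
  p₅ (inj₁ (≡2∨3 , 4<D)) = count 5 4 (ℕ.<⇒≤ 4<D) (⊥-elim ∘ mod4≢1 {D} ≡2∨3)
  p₅ (inj₂ (_ , 25<D))   = count 5 25 (ℕ.<⇒≤ 25<D) (const refl)

  p₆ : (((D % 4 ≡ 2 ⊎ D % 4 ≡ 3) × 9 < D) ⊎ (D % 4 ≡ 1 × 25 < D)) → PartitionCount D (natE 6) 11
  p₆ (inj₁ (≡2∨3 , 9<D)) = count 6 10 9<D (⊥-elim ∘ mod4≢1 {D} ≡2∨3)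
  p₆ (inj₂ (_ , 25<D))   = count 6 25 (ℕ.<⇒≤ 25<D) (const refl)
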